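{- Let $m$ be a positive integer and $G$ a graph with $|V(G)|\ge m$. Let $S\subseteq V(G)$ be a set of $m$ vertices of largest degree in $G$ (i.e. every vertex of $S$ has degree at least that of every vertex outside $S$). If $e(G\setminus S)\ge m^2$, then there is a subgraph $H\subseteq G$ with $\Delta(H)\le m$ and $e(H)\ge m^2/2$.
   Context: $G\setminus S$ denotes the graph obtained from $G$ by deleting the vertices of $S$; $e(\cdot)$ is the number of edges and $\Delta(\cdot)$ the maximum degree. -}

module Defs where

open import Data.Bool using (Bool; true; false; _∧_; not; if_then_else_)
open import Data.Nat using (ℕ; zero; suc; _+_; _<ᵇ_)
open import Data.Fin using (Fin; toℕ)
import Data.Fin as F
open import Data.Fin.Subset using (Subset; inside)
open import Data.Vec using (lookup)
open import Relation.Binary.PropositionalEquality using (_≡_)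

record Graph (n : ℕ) : Set where
  field
    adj   : Fin n → Fin n → Bool
    sym   : ∀ u v → adj u v ≡ adj v u
    irrefl : ∀ v → adj v v ≡ false
open Graph public

count : ∀ {n} → (Fin n → Bool) → ℕ
count {zero}  p = 0
count {suc n} p = (if p F.zero then 1 else 0) + count (λ i → p (F.suc i))

sumF : ∀ {n} → (Fin n → ℕ) → ℕ
sumF {zero}  f = 0
sumF {suc n} f = f F.zero + sumF (λ i → f (F.suc i))

deg : ∀ {n} → Graph n → Fin n → ℕ
deg G v = count (λ u → adj G v u)

edges : ∀ {n} → Graph n → ℕ
edges G = sumF (λ i → count (λ j → (toℕ i <ᵇ toℕ j) ∧ adj G i j))

mem : ∀ {n} → Subset n → Fin n → Bool
mem S i = lookup S i

edgesOutside : ∀ {n} → Graph n → Subset n → ℕ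
edgesOutside G S =
  sumF (λ i → count (λ j →
    (toℕ i <ᵇ toℕ j) ∧ (adj G i j ∧ (not (mem S i) ∧ not (mem S j)))))

-- H is a subgraph of G (on the same vertex set; deleted vertices are
-- simply isolated, which does not affect Δ(H) or e(H))
_⊆G_ : ∀ {n} → Graph n → Graph n → Set
H ⊆G G = ∀ u v → adj H u v ≡ true → adj G u v ≡ true

module Submission where

-- We split on whether some
-- vertex of S has degree at most m.
--  * If so, every vertex outside S has degree at most m too, so G ∖ S
--    (the vertices of S kept but isolated) is the required subgraph: its
--    maximum degree is at most m and it has e(G ∖ S) ≥ m² ≥ m²/2 edges.
--  * If not, every vertex of S has degree above m.  Keep all edges inside
--    S, let each u ∈ S keep m − d_S(u) of its edges leaving S (d_S(u) is the
--    number of neighbours of u in S), and drop the edges outside S.  Then each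
--    vertex of S has degree exactly m and each vertex outside S has degree
--    at most |S| = m, so by the handshake lemma 2e(H) = Σ deg ≥ |S|·m = m².

open import Defs hiding (sym)
open import Data.Nat using (ℕ; _≤_; _*_)
open import Data.Fin using (Fin)
open import Data.Fin.Subset using (Subset; ∣_∣; _∈_; _∉_)
open import Data.Product using (Σ; _×_)
open import Relation.Binary.PropositionalEquality using (_≡_)

open import Data.Nat using (zero; suc; _+_; _∸_; _⊓_; _<_; _<ᵇ_; z≤n; s≤s)
open import Data.Nat.Properties
open import Data.Bool using (Bool; true; false; _∧_; not; if_then_else_)
open import Data.Bool.Properties using (∧-comm; ∧-zeroʳ; T-≡; ¬-not)
open import Data.Fin using (toℕ) renaming (zero to fzero; suc to fsuc)
open import Data.Fin.Properties using (any?; toℕ-injective)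
open import Data.Fin.Subset.Properties using (_∈?_)
open import Data.Vec using ([]; _∷_)
open import Data.Vec.Properties using ([]=⇒lookup; lookup⇒[]=)
open import Data.Product using (_,_)
open import Data.Sum using (_⊎_; inj₁; inj₂)
open import Function.Bundles using (Equivalence)
open import Relation.Binary using (tri<; tri≈; tri>)
open import Relation.Nullary using (yes; no; ¬_)
open import Relation.Nullary.Decidable using (_×-dec_)
open import Relation.Binary.PropositionalEquality
  using (refl; sym; trans; cong; cong₂; subst; module ≡-Reasoning)
import Algebra.Properties.CommutativeMonoid.Sum as MonoidSum

module ∑ = MonoidSum +-0-commutativeMonoid

∧-true₁ : ∀ x y → x ∧ y ≡ true → x ≡ true
∧-true₁ true y _ = refl

∧-true₂ : ∀ x y → x ∧ y ≡ true → y ≡ true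
∧-true₂ true y x∧y = x∧y

∧-absorbˡ : ∀ x y → (y ≡ true → x ≡ true) → x ∧ y ≡ y
∧-absorbˡ true  y     _ = refl
∧-absorbˡ false false _ = refl
∧-absorbˡ false true  y⇒x = y⇒x refl

ind : Bool → ℕ
ind b = if b then 1 else 0

count-cong : ∀ {n} {p q : Fin n → Bool} → (∀ x → p x ≡ q x) → count p ≡ count q
count-cong {zero}  p≗q = refl
count-cong {suc n} p≗q = cong₂ _+_ (cong ind (p≗q fzero)) (count-cong (λ i → p≗q (fsuc i)))

count-false : ∀ {n} → count {n} (λ _ → false) ≡ 0
count-false {zero}  = refl
count-false {suc n} = count-false {n}

count-mono : ∀ {n} {p q : Fin n → Bool} → (∀ x → p x ≡ true → q x ≡ true) →
  count p ≤ count q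
count-mono {zero} p⇒q = z≤n
count-mono {suc n} {p} {q} p⇒q with p fzero in p0 | q fzero in q0
... | false | false = count-mono (λ i → p⇒q (fsuc i))
... | false | true  = m≤n⇒m≤1+n (count-mono (λ i → p⇒q (fsuc i)))
... | true  | true  = s≤s (count-mono (λ i → p⇒q (fsuc i)))
... | true  | false with trans (sym q0) (p⇒q fzero p0)
... | ()

count-split : ∀ {n} (b p : Fin n → Bool) →
  count p ≡ count (λ x → b x ∧ p x) + count (λ x → not (b x) ∧ p x)
count-split {zero} b p = refl
count-split {suc n} b p with b fzero | p fzero
... | true  | true  = cong suc (count-split (λ i → b (fsuc i)) (λ i → p (fsuc i)))
... | true  | false = count-split (λ i → b (fsuc i)) (λ i → p (fsuc i))
... | false | false = count-split (λ i → b (fsuc i)) (λ i → p (fsuc i))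
... | false | true  = trans (cong suc (count-split (λ i → b (fsuc i)) (λ i → p (fsuc i))))
                            (sym (+-suc _ _))

count-if : ∀ {n} (b p q : Fin n → Bool) →
  count (λ x → if b x then p x else q x)
    ≡ count (λ x → b x ∧ p x) + count (λ x → not (b x) ∧ q x)
count-if b p q = trans (count-split b _) (cong₂ _+_ (count-cong on-b) (count-cong off-b))
  where
  on-b : ∀ x → b x ∧ (if b x then p x else q x) ≡ b x ∧ p x
  on-b x with b x
  ... | true  = refl
  ... | false = refl
  off-b : ∀ x → not (b x) ∧ (if b x then p x else q x) ≡ not (b x) ∧ q x
  off-b x with b x
  ... | true  = refl
  ... | false = refl

count-mem : ∀ {n} (S : Subset n) → count (mem S) ≡ ∣ S ∣
count-mem []          = refl
count-mem (true ∷ S)  = cong suc (count-mem S)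
count-mem (false ∷ S) = count-mem S

sumF≡∑ : ∀ {n} (f : Fin n → ℕ) → sumF f ≡ ∑.sum f
sumF≡∑ {zero}  f = refl
sumF≡∑ {suc n} f = cong (f fzero +_) (sumF≡∑ (λ i → f (fsuc i)))

sumF-cong : ∀ {n} {f g : Fin n → ℕ} → (∀ x → f x ≡ g x) → sumF f ≡ sumF g
sumF-cong {f = f} {g} f≗g =
  trans (sumF≡∑ f) (trans (∑.sum-cong-≗ f≗g) (sym (sumF≡∑ g)))

sumF-+ : ∀ {n} (f g : Fin n → ℕ) → sumF (λ i → f i + g i) ≡ sumF f + sumF g
sumF-+ f g = begin
  sumF (λ i → f i + g i)   ≡⟨ sumF≡∑ (λ i → f i + g i) ⟩
  ∑.sum (λ i → f i + g i)  ≡⟨ ∑.∑-distrib-+ f g ⟩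
  ∑.sum f + ∑.sum g        ≡⟨ sym (cong₂ _+_ (sumF≡∑ f) (sumF≡∑ g)) ⟩
  sumF f + sumF g          ∎
  where open ≡-Reasoning

sumF-comm : ∀ {m n} (f : Fin m → Fin n → ℕ) →
  sumF (λ i → sumF (f i)) ≡ sumF (λ j → sumF (λ i → f i j))
sumF-comm f = begin
  sumF (λ i → sumF (f i))                ≡⟨ sumF-cong (λ i → sumF≡∑ (f i)) ⟩
  sumF (λ i → ∑.sum (f i))               ≡⟨ sumF≡∑ (λ i → ∑.sum (f i)) ⟩
  ∑.sum (λ i → ∑.sum (f i))              ≡⟨ ∑.∑-comm f ⟩
  ∑.sum (λ j → ∑.sum (λ i → f i j))      ≡⟨ sym (sumF≡∑ (λ j → ∑.sum (λ i → f i j))) ⟩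
  sumF (λ j → ∑.sum (λ i → f i j))       ≡⟨ sym (sumF-cong (λ j → sumF≡∑ (λ i → f i j))) ⟩
  sumF (λ j → sumF (λ i → f i j))        ∎
  where open ≡-Reasoning

sumF-mono : ∀ {n} {f g : Fin n → ℕ} → (∀ x → f x ≤ g x) → sumF f ≤ sumF g
sumF-mono {zero}  f≤g = z≤n
sumF-mono {suc n} f≤g = +-mono-≤ (f≤g fzero) (sumF-mono (λ i → f≤g (fsuc i)))

count≡sumF : ∀ {n} (p : Fin n → Bool) → count p ≡ sumF (λ x → ind (p x))
count≡sumF {zero}  p = refl
count≡sumF {suc n} p = cong (ind (p fzero) +_) (count≡sumF (λ i → p (fsuc i)))

sumF-weighted : ∀ {n} (b : Fin n → Bool) (k : ℕ) →
  sumF (λ x → if b x then k else 0) ≡ count b * k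
sumF-weighted {zero}  b k = refl
sumF-weighted {suc n} b k with b fzero
... | true  = cong (k +_) (sumF-weighted (λ i → b (fsuc i)) k)
... | false = sumF-weighted (λ i → b (fsuc i)) k

-- The handshake lemma.  Each edge is counted in `edges` from its smaller
-- endpoint; a degree splits into the neighbours above and below the vertex.

<ᵇ-true : ∀ {m n} → m < n → (m <ᵇ n) ≡ true
<ᵇ-true m<n = Equivalence.to T-≡ (<⇒<ᵇ m<n)

<ᵇ-false : ∀ {m n} → ¬ (m < n) → (m <ᵇ n) ≡ false
<ᵇ-false {m} {n} m≮n = ¬-not (λ eq → m≮n (<ᵇ⇒< m n (Equivalence.from T-≡ eq)))

-- A neighbour j of i that is not above i is a neighbour that sees i above
-- itself (j = i is excluded by irreflexivity).
lower-neighbour : ∀ {n} (H : Graph n) (i j : Fin n) →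
  not (toℕ i <ᵇ toℕ j) ∧ adj H i j ≡ (toℕ j <ᵇ toℕ i) ∧ adj H j i
lower-neighbour H i j with <-cmp (toℕ i) (toℕ j)
... | tri< i<j _ j≮i rewrite <ᵇ-true i<j | <ᵇ-false j≮i = refl
... | tri> i≮j _ j<i rewrite <ᵇ-false i≮j | <ᵇ-true j<i = Graph.sym H i j
... | tri≈ _ i≡j _ rewrite toℕ-injective i≡j | irrefl H j =
  trans (∧-zeroʳ _) (sym (∧-zeroʳ _))

handshake : ∀ {n} (H : Graph n) → sumF (deg H) ≡ 2 * edges H
handshake {n} H = begin
  sumF (deg H)                                      ≡⟨ sumF-cong deg-split ⟩
  sumF (λ i → count (up i) + count (λ j → up j i))  ≡⟨ sumF-+ (λ i → count (up i)) (λ i → count (λ j → up j i)) ⟩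
  edges H + sumF (λ i → count (λ j → up j i))       ≡⟨ cong (edges H +_) down-sum ⟩
  edges H + edges H                                 ≡⟨ cong (edges H +_) (sym (+-identityʳ _)) ⟩
  2 * edges H                                       ∎
  where
  open ≡-Reasoning
  up : Fin n → Fin n → Bool
  up i j = (toℕ i <ᵇ toℕ j) ∧ adj H i j
  deg-split : ∀ i → deg H i ≡ count (up i) + count (λ j → up j i)
  deg-split i = trans (count-split (λ j → toℕ i <ᵇ toℕ j) (adj H i))
                      (cong (count (up i) +_) (count-cong (lower-neighbour H i)))
  down-sum : sumF (λ i → count (λ j → up j i)) ≡ edges H
  down-sum = begin
    sumF (λ i → count (λ j → up j i))         ≡⟨ sumF-cong (λ i → count≡sumF (λ j → up j i)) ⟩
    sumF (λ i → sumF (λ j → ind (up j i)))    ≡⟨ sumF-comm (λ i j → ind (up j i)) ⟩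
    sumF (λ j → sumF (λ i → ind (up j i)))    ≡⟨ sym (sumF-cong (λ j → count≡sumF (up j))) ⟩
    edges H                                   ∎

edges-from-degrees : ∀ {n} (H : Graph n) (S : Subset n) (k : ℕ) →
  (∀ v → mem S v ≡ true → k ≤ deg H v) → ∣ S ∣ * k ≤ 2 * edges H
edges-from-degrees H S k big = begin
  ∣ S ∣ * k                            ≡⟨ cong (_* k) (sym (count-mem S)) ⟩
  count (mem S) * k                    ≡⟨ sym (sumF-weighted (mem S) k) ⟩
  sumF (λ v → if mem S v then k else 0) ≤⟨ sumF-mono weight≤deg ⟩
  sumF (deg H)                         ≡⟨ handshake H ⟩
  2 * edges H                          ∎
  where
  open ≤-Reasoning
  weight≤deg : ∀ v → (if mem S v then k else 0) ≤ deg H v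
  weight≤deg v with mem S v in v∈S
  ... | true  = big v v∈S
  ... | false = z≤n

trunc : ∀ {n} → (Fin n → Bool) → ℕ → Fin n → Bool
trunc {suc n} p k fzero    = p fzero ∧ (0 <ᵇ k)
trunc {suc n} p k (fsuc i) = trunc (λ j → p (fsuc j)) (if p fzero then k ∸ 1 else k) i

trunc-⊆ : ∀ {n} (p : Fin n → Bool) k x → trunc p k x ≡ true → p x ≡ true
trunc-⊆ {suc n} p k fzero    t = ∧-true₁ (p fzero) _ t
trunc-⊆ {suc n} p k (fsuc i) t = trunc-⊆ (λ j → p (fsuc j)) _ i t

count-trunc : ∀ {n} (p : Fin n → Bool) k → count (trunc p k) ≡ k ⊓ count p
count-trunc {zero} p k = sym (⊓-zeroʳ k)
count-trunc {suc n} p k with p fzero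
... | false = count-trunc (λ j → p (fsuc j)) k
... | true with k
...   | zero   = count-trunc (λ j → p (fsuc j)) 0
...   | suc k′ = cong suc (count-trunc (λ j → p (fsuc j)) k′)

mem⇒∈ : ∀ {n} (S : Subset n) v → mem S v ≡ true → v ∈ S
mem⇒∈ S v = lookup⇒[]= v S

∉⇒¬mem : ∀ {n} (S : Subset n) v → v ∉ S → mem S v ≡ false
∉⇒¬mem S v v∉S = ¬-not (λ v∈S → v∉S (mem⇒∈ S v v∈S))

BoundedSubgraph : ∀ {n} → ℕ → Graph n → Set
BoundedSubgraph {n} k G =
  Σ (Graph n) (λ H → (H ⊆G G) × ((∀ v → deg H v ≤ k) × (k * k ≤ 2 * edges H)))

_∖_ : ∀ {n} → Graph n → Subset n → Graph n
G ∖ S = record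
  { adj    = λ u v → adj G u v ∧ (not (mem S u) ∧ not (mem S v))
  ; sym    = λ u v → cong₂ _∧_ (Graph.sym G u v) (∧-comm (not (mem S u)) (not (mem S v)))
  ; irrefl = λ v → cong (_∧ (not (mem S v) ∧ not (mem S v))) (irrefl G v)
  }

module _ {n} (G : Graph n) (S : Subset n) where

  ∖-⊆G : (G ∖ S) ⊆G G
  ∖-⊆G u v uv = ∧-true₁ (adj G u v) _ uv

  ∖-deg≤ : ∀ v → deg (G ∖ S) v ≤ deg G v
  ∖-deg≤ v = count-mono (λ u vu → ∧-true₁ (adj G v u) _ vu)

  ∖-isolated : ∀ v → v ∈ S → deg (G ∖ S) v ≡ 0
  ∖-isolated v v∈S = trans (count-cong no-edge) (count-false {n})
    where
    no-edge : ∀ u → adj G v u ∧ (not (mem S v) ∧ not (mem S u)) ≡ false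
    no-edge u rewrite []=⇒lookup v∈S = ∧-zeroʳ (adj G v u)

  deletion-subgraph : ∀ k → (∀ v → v ∉ S → deg G v ≤ k) →
    k * k ≤ edgesOutside G S → BoundedSubgraph k G
  deletion-subgraph k small k²≤e = G ∖ S , ∖-⊆G , Δ≤k , ≤-trans k²≤e (m≤m+n _ _)
    where
    Δ≤k : ∀ v → deg (G ∖ S) v ≤ k
    Δ≤k v with v ∈? S
    ... | yes v∈S = ≤-trans (≤-reflexive (∖-isolated v v∈S)) z≤n
    ... | no  v∉S = ≤-trans (∖-deg≤ v) (small v v∉S)

block : (u∈S v∈S inner uChoosesV vChoosesU : Bool) → Bool
block true  true  inner _  _  = inner
block true  false _     uv _  = uv
block false true  _     _  vu = vu
block false false _     _  _  = false

block-sym : ∀ b c x x′ y z → x ≡ x′ → block b c x y z ≡ block c b x′ z y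
block-sym true  true  x x′ y z x≡x′ = x≡x′
block-sym true  false x x′ y z _    = refl
block-sym false true  x x′ y z _    = refl
block-sym false false x x′ y z _    = refl

block-irrefl : ∀ b x y → x ≡ false → block b b x y y ≡ false
block-irrefl true  x y x≡false = x≡false
block-irrefl false x y _       = refl

block-source : ∀ b c x y z → block b c x y z ≡ true → x ≡ true ⊎ (y ≡ true ⊎ z ≡ true)
block-source true  true  x y z e = inj₁ e
block-source true  false x y z e = inj₂ (inj₁ e)
block-source false true  x y z e = inj₂ (inj₂ e)

block-inside : ∀ {b} c x y z → b ≡ true → block b c x y z ≡ (if c then x else y)
block-inside true  x y z refl = refl
block-inside false x y z refl = refl

block-outside : ∀ {b} c x y z → b ≡ false → block b c x y z ≡ true → c ≡ true
block-outside true x y z refl _ = refl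

module Saturation (k : ℕ) {n} (G : Graph n) (S : Subset n) where

  toS leaveS : Fin n → Fin n → Bool
  toS    u w = adj G u w ∧ mem S w
  leaveS u w = adj G u w ∧ not (mem S w)

  dS : Fin n → ℕ
  dS u = count (toS u)

  chosen : Fin n → Fin n → Bool
  chosen u = trunc (leaveS u) (k ∸ dS u)

  chosen-⊆G : ∀ u v → chosen u v ≡ true → adj G u v ≡ true
  chosen-⊆G u v uv = ∧-true₁ (adj G u v) _ (trunc-⊆ (leaveS u) _ v uv)

  chosen-leaves : ∀ u v → chosen u v ≡ true → not (mem S v) ≡ true
  chosen-leaves u v uv = ∧-true₂ (adj G u v) _ (trunc-⊆ (leaveS u) _ v uv)

  H : Graph n
  H = record
    { adj    = λ u v → block (mem S u) (mem S v) (adj G u v) (chosen u v) (chosen v u)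
    ; sym    = λ u v → block-sym (mem S u) (mem S v) _ _ (chosen u v) (chosen v u) (Graph.sym G u v)
    ; irrefl = λ v → block-irrefl (mem S v) (adj G v v) (chosen v v) (irrefl G v)
    }

  H-⊆G : H ⊆G G
  H-⊆G u v uv with block-source (mem S u) (mem S v) (adj G u v) (chosen u v) (chosen v u) uv
  ... | inj₁ inner       = inner
  ... | inj₂ (inj₁ u→v) = chosen-⊆G u v u→v
  ... | inj₂ (inj₂ v→u) = trans (Graph.sym G u v) (chosen-⊆G v u v→u)

  deg-split : ∀ u → deg G u ≡ dS u + count (leaveS u)
  deg-split u = trans (count-split (mem S) (adj G u))
    (cong₂ _+_ (count-cong (λ v → ∧-comm (mem S v) (adj G u v)))
               (count-cong (λ v → ∧-comm (not (mem S v)) (adj G u v))))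

  dS≤∣S∣ : ∀ u → dS u ≤ ∣ S ∣
  dS≤∣S∣ u = ≤-trans (count-mono (λ v uv → ∧-true₂ (adj G u v) _ uv)) (≤-reflexive (count-mem S))

  H-deg-outside : ∀ v → mem S v ≡ false → deg H v ≤ ∣ S ∣
  H-deg-outside v v∉S =
    ≤-trans (count-mono (λ u vu → block-outside (mem S u) (adj G v u) (chosen v u) (chosen u v) v∉S vu))
            (≤-reflexive (count-mem S))

  enough-leaving : ∀ u → k ≤ deg G u → k ∸ dS u ≤ count (leaveS u)
  enough-leaving u k≤deg = begin
    k ∸ dS u                        ≤⟨ ∸-monoˡ-≤ (dS u) k≤deg ⟩
    deg G u ∸ dS u                  ≡⟨ cong (_∸ dS u) (deg-split u) ⟩
    dS u + count (leaveS u) ∸ dS u  ≡⟨ m+n∸m≡n (dS u) (count (leaveS u)) ⟩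
    count (leaveS u)                ∎
    where open ≤-Reasoning

  H-deg-inside : ∀ u → mem S u ≡ true → dS u ≤ k → k ≤ deg G u → deg H u ≡ k
  H-deg-inside u u∈S dS≤k k≤deg = begin
    deg H u                                                    ≡⟨ count-cong (λ v → block-inside (mem S v) _ _ (chosen v u) u∈S) ⟩
    count (λ v → if mem S v then adj G u v else chosen u v)    ≡⟨ count-if (mem S) (adj G u) (chosen u) ⟩
    count (λ v → mem S v ∧ adj G u v) + count (λ v → not (mem S v) ∧ chosen u v)
      ≡⟨ cong₂ _+_ (count-cong (λ v → ∧-comm (mem S v) (adj G u v)))
                   (count-cong (λ v → ∧-absorbˡ (not (mem S v)) (chosen u v) (chosen-leaves u v))) ⟩
    dS u + count (chosen u)                                    ≡⟨ cong (dS u +_) (count-trunc (leaveS u) (k ∸ dS u)) ⟩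
    dS u + (k ∸ dS u) ⊓ count (leaveS u)                       ≡⟨ cong (dS u +_) (m≤n⇒m⊓n≡m (enough-leaving u k≤deg)) ⟩
    dS u + (k ∸ dS u)                                          ≡⟨ m+[n∸m]≡n dS≤k ⟩
    k                                                          ∎
    where open ≡-Reasoning

saturated-subgraph : ∀ {n} k (G : Graph n) (S : Subset n) → ∣ S ∣ ≡ k →
  (∀ u → u ∈ S → k ≤ deg G u) → BoundedSubgraph k G
saturated-subgraph k G S ∣S∣≡k big = H , H-⊆G , Δ≤k , k²≤2e
  where
  open Saturation k G S
  exactly-k : ∀ u → mem S u ≡ true → deg H u ≡ k
  exactly-k u u∈S = H-deg-inside u u∈S (≤-trans (dS≤∣S∣ u) (≤-reflexive ∣S∣≡k)) (big u (mem⇒∈ S u u∈S))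
  Δ≤k : ∀ v → deg H v ≤ k
  Δ≤k v with v ∈? S
  ... | yes v∈S = ≤-reflexive (exactly-k v ([]=⇒lookup v∈S))
  ... | no  v∉S = ≤-trans (H-deg-outside v (∉⇒¬mem S v v∉S)) (≤-reflexive ∣S∣≡k)
  k²≤2e : k * k ≤ 2 * edges H
  k²≤2e = subst (λ s → s * k ≤ 2 * edges H) ∣S∣≡k
                (edges-from-degrees H S k (λ u u∈S → ≤-reflexive (sym (exactly-k u u∈S))))

lemma4 : (m n : ℕ) → 1 ≤ m → m ≤ n → (G : Graph n) → (S : Subset n) →
    ∣ S ∣ ≡ m →
    (∀ u v → u ∈ S → v ∉ S → deg G v ≤ deg G u) →
    m * m ≤ edgesOutside G S →
    Σ (Graph n) (λ H → (H ⊆G G) × ((∀ v → deg H v ≤ m) × (m * m ≤ 2 * edges H)))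
lemma4 m n _ _ G S ∣S∣≡m S-largest m²≤e
  with any? (λ s → (s ∈? S) ×-dec (deg G s ≤? m))
... | yes (s , s∈S , deg-s≤m) =
  deletion-subgraph G S m (λ v v∉S → ≤-trans (S-largest s v s∈S v∉S) deg-s≤m) m²≤e
... | no no-small-in-S =
  saturated-subgraph m G S ∣S∣≡m (λ u u∈S → ≰⇒≥ (λ deg≤m → no-small-in-S (u , u∈S , deg≤m)))
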